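{- Let $H$ be a connected hypergraph with a minimal edge cut $F$, and let $\{ V_0, V_1 \}$ be a partition of $V(H)$ such that each of $V_0,V_1$ is a union of the vertex sets of connected components of $H \backslash F$. If $H$ admits an Euler tour, then there exists an edge cut assignment $\alpha: F \to \mathbb{Z}_2^{[2]}$ such that $|\alpha^{ -1}(01)|$ is even, and either (i) $\alpha^{ -1}(01) = \emptyset$ and, for some $i\in\mathbb{Z}_2$, $H^{\alpha}[V_i]$ has an Euler tour and $H^{\alpha}[V_{1-i}]$ is empty, or (ii) $\alpha^{ -1}(01) \ne \emptyset$, and for each $i \in \mathbb{Z}_2$, the collapsed hypergraph $H^{\alpha} \circ V_i$ has an Euler tour that traverses its collapsed vertex $u_i^{\circ}$ via each of the edges in $\{ (f^{\alpha})^{\circ}: f \in \alpha^{ -1}(01) \}$.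
   Context: A hypergraph $H=(V,E)$: non-empty finite vertex set $V$ and finite multiset $E$ of subsets of $V$ (edges); it is empty if it has no edges. Distinct $u,v$ are adjacent via $e$ if $u,v\in e$. A walk is $v_0e_1v_1\ldots e_kv_k$ with $v_{i-1},v_i$ adjacent via $e_i$; closed if $v_0=v_k$, $k\ge2$; trail if edges are pairwise distinct; it traverses vertex $v$ via edge $e$ if $ev$ or $ve$ is a consecutive subsequence. An Euler tour is a closed trail traversing every edge. Connected components are maximal connected subhypergraphs without empty edges. For $V'\subseteq V$, $H[V']$ has vertex set $V'$ and edge multiset $\{\!\{e\cap V': e\in E, e\cap V'\ne\emptyset\}\!\}$. For $F\subseteq E$, $H\backslash F=(V,E-F)$. An edge cut is a set $[S,V-S]_H=\{e\in E: e\cap S\ne\emptyset\ne e\cap(V-S)\}$ for non-empty proper $S\subset V$; minimal if it properly contains no other edge cut. $\mathbb{Z}_2^{[2]}=\{00,01,11\}$. An edge cut assignment $\alpha:F\to\mathbb{Z}_2^{[2]}$ satisfies: $\alpha(f)=01$ implies $f\cap V_0\ne\emptyset\ne f\cap V_1$, and $\alpha(f)=ii$ implies $|f\cap V_i|\ge 2$. For $e\in E$: $e^\alpha=e\cap(V_i\cup V_j)$ if $e\in F$, $\alpha(e)=ij$; $e^\alpha=e$ if $e\notin F$. $H^\alpha$ has vertex set $V(H)$ and edge multiset $\{\!\{e^\alpha:e\in E(H)\}\!\}$. For a hypergraph $K$ and $\emptyset\ne S\subsetneq V(K)$, the collapsed hypergraph $K\circ S$ has vertex set $(V(K)-S)\cup\{u^\circ\}$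 ($u^\circ$ a new vertex, the collapsed vertex) and edge multiset $\{\!\{e^\circ: e\in E(K), |e\cap(V(K)-S)|\ge1\}\!\}$, where $e^\circ=e$ if $e\cap S=\emptyset$ and $e^\circ=(e-S)\cup\{u^\circ\}$ otherwise. The collapsed vertex of $H^\alpha\circ V_i$ is denoted $u_i^\circ$. -}

module Defs where

open import Data.Nat using (ℕ; suc; _≤_)
open import Data.Bool using (Bool; true; false; not; if_then_else_)
open import Data.Fin using (Fin; zero; suc)
open import Data.Fin.Subset using (Subset; _∈_; _∉_; _⊆_; _⊂_; ∁; _∩_; ∣_∣; Nonempty; Empty)
open import Data.Fin.Subset.Properties using (nonempty?)
open import Data.Vec using (Vec; _∷_; lookup; tabulate)
open import Data.List using (List; []; _∷_; length)
open import Data.List.Membership.Propositional using () renaming (_∈_ to _∈ₗ_)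
open import Data.List.Relation.Unary.Unique.Propositional using (Unique)
open import Data.Product using (Σ; ∃; _×_; _,_)
open import Data.Unit using (⊤)
open import Data.Empty using (⊥)
open import Relation.Nullary using (¬_)
open import Relation.Nullary.Decidable using (⌊_⌋)
open import Relation.Binary.PropositionalEquality using (_≡_; _≢_)

-- The vertices are (a subset of) Fin n; the edge multiset
-- is given by an indexed family  E : Fin m → Subset n  (repeated edges
-- are distinct indices).  A sub-multiset of the edges (e.g. H \ F, or
-- the edges of H[V'] / of a collapsed hypergraph) is described by an
-- "activity" predicate  act : Fin m → Set  on the edge indices.

module _ {n m : ℕ} (act : Fin m → Set) (E : Fin m → Subset n) where

  data Walk : Fin n → Fin n → List (Fin m) → Set where
    []   : ∀ {v} → Walk v v []
    step : ∀ {u v w e es} → act e → u ≢ v → u ∈ E e → v ∈ E e →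
           Walk v w es → Walk u w (e ∷ es)

  data Traverses : ∀ {u w es} → Walk u w es → Fin n → Fin m → Set where
    here-l : ∀ {u v w e es a d p q} {W : Walk v w es} →
             Traverses (step {u} {v} {w} {e} {es} a d p q W) u e
    here-r : ∀ {u v w e es a d p q} {W : Walk v w es} →
             Traverses (step {u} {v} {w} {e} {es} a d p q W) v e
    there  : ∀ {u v w e es a d p q x f} {W : Walk v w es} →
             Traverses W x f →
             Traverses (step {u} {v} {w} {e} {es} a d p q W) x f

  record EulerTour : Set where
    field
      start  : Fin n
      edges  : List (Fin m)
      walk   : Walk start start edges
      closed : 2 ≤ length edges
      trail  : Unique edges
      covers : ∀ j → act j → j ∈ₗ edges

  HasEulerTour : Set
  HasEulerTour = EulerTour

  Connected : Set
  Connected = ∀ (u v : Fin n) → ∃ λ es → Walk u v es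

module _ {n m : ℕ} (E : Fin m → Subset n) where

  IsEdgeCut : Subset m → Set
  IsEdgeCut F = ∃ λ (S : Subset n) → Nonempty S × Nonempty (∁ S) ×
    (∀ j → (j ∈ F → Nonempty (E j ∩ S) × Nonempty (E j ∩ ∁ S)) ×
           (Nonempty (E j ∩ S) × Nonempty (E j ∩ ∁ S) → j ∈ F))

  IsMinimalEdgeCut : Subset m → Set
  IsMinimalEdgeCut F = IsEdgeCut F × (∀ F' → IsEdgeCut F' → ¬ (F' ⊂ F))

  NotIn : Subset m → Fin m → Set
  NotIn F j = j ∉ F

  -- S is a union of vertex sets of connected components of H \ F,
  -- i.e. S is closed under reachability in H \ F.
  UnionOfComponents : Subset m → Subset n → Set
  UnionOfComponents F S =
    ∀ u v es → u ∈ S → Walk (NotIn F) E u v es → v ∈ S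

data Z2² : Set where
  c00 c01 c11 : Z2²

-- the part V_i of the partition {V₀, V₁}, with V₁ = V - V₀; i ∈ Z₂ = Bool
-- (false = 0, true = 1)
part : ∀ {n} → Subset n → Bool → Subset n
part V₀ false = V₀
part V₀ true  = ∁ V₀

module _ {n m : ℕ} (E : Fin m → Subset n) (F : Subset m) (V₀ : Subset n) where

  -- α : F → Z₂^[2] is an edge cut assignment (values off F are ignored)
  IsEdgeCutAssignment : (Fin m → Z2²) → Set
  IsEdgeCutAssignment α = ∀ j → j ∈ F →
    (α j ≡ c01 → Nonempty (E j ∩ part V₀ false) × Nonempty (E j ∩ part V₀ true)) ×
    (α j ≡ c00 → 2 ≤ ∣ E j ∩ part V₀ false ∣) ×
    (α j ≡ c11 → 2 ≤ ∣ E j ∩ part V₀ true ∣)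

  restrictα : Z2² → Subset n → Subset n
  restrictα c00 e = e ∩ part V₀ false
  restrictα c01 e = e
  restrictα c11 e = e ∩ part V₀ true

  edgeα : (Fin m → Z2²) → Fin m → Subset n
  edgeα α j = if lookup F j then restrictα (α j) (E j) else E j

  preimage01 : (Fin m → Z2²) → Subset m
  preimage01 α = tabulate λ j → if lookup F j then is01 (α j) else false
    where
    is01 : Z2² → Bool
    is01 c01 = true
    is01 _   = false

module _ {n m : ℕ} (E : Fin m → Subset n) (V' : Subset n) where

  inducedAct : Fin m → Set
  inducedAct j = Nonempty (E j ∩ V')

  inducedEdge : Fin m → Subset n
  inducedEdge j = E j ∩ V'

  InducedHasEulerTour : Set
  InducedHasEulerTour = EulerTour inducedAct inducedEdge

  InducedEmpty : Set
  InducedEmpty = ∀ j → ¬ inducedAct j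

-- Collapsed hypergraph K ∘ S of K = (Fin n, E): vertex set
-- (V - S) ∪ {u°} inside Fin (suc n), where u° = zero and an old vertex
-- v is suc v.  Edges e° for e with e ∩ (V - S) ≠ ∅.

collapsedVertex : ∀ {n} → Fin (suc n)
collapsedVertex = zero

module _ {n m : ℕ} (E : Fin m → Subset n) (S : Subset n) where

  collapsedAct : Fin m → Set
  collapsedAct j = Nonempty (E j ∩ ∁ S)

  -- e° = e if e ∩ S = ∅, and (e - S) ∪ {u°} otherwise
  collapsedEdge : Fin m → Subset (suc n)
  collapsedEdge j = ⌊ nonempty? (E j ∩ S) ⌋ ∷ (E j ∩ ∁ S)

  CollapsedEulerTour : Set
  CollapsedEulerTour = EulerTour collapsedAct collapsedEdge

-- The Euler tour traverses every edge exactly once; let α(f) be ii when that traversal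
-- joins two vertices of V_i, and 01 when it joins V₀ to V₁.  An edge outside F lies inside
-- one V_i, so α⁻¹(01) is exactly the set of crossing edges, and a closed walk crosses between
-- V₀ and V₁ an even number of times.  If the tour never crosses, it stays in the V_i of its
-- start, is an Euler tour of H^α[V_i], and no edge of H^α meets V_{1-i}.  Otherwise, for each
-- i, sending V_i to u_i° and deleting the steps inside V_i turns the tour into an Euler tour
-- of H^α ∘ V_i, and every crossing step passes through u_i°.

module Submission where

open import Defs
open import Data.Nat using (ℕ)
open import Data.Nat.Divisibility using (_∣_)
open import Data.Bool using (Bool; not)
open import Data.Fin using (Fin)
open import Data.Fin.Subset using (Subset; _∈_; ∣_∣; Nonempty; Empty; ∁)
open import Data.Product using (Σ; ∃; _×_; _,_)
open import Data.Sum using (_⊎_)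
open import Data.Unit using (⊤)

open import Function using (_∘_; case_of_)
open import Data.Nat using (zero; suc; _≤_; z≤n; s≤s)
open import Data.Nat.Properties using (m≤n⇒m≤1+n)
open import Data.Nat.Divisibility using (divides)
open import Data.Bool using (true; false; _xor_)
open import Data.Bool.Properties using (not-involutive; ¬-not; not-¬; not-distribˡ-xor; xor-same) renaming (_≟_ to _≟ᵇ_)
open import Data.Fin using (zero; suc; _≟_)
open import Data.Fin.Subset using (_∉_; _∩_; _-_)
open import Data.Fin.Subset.Properties
  using (_∈?_; x∈p∩q⁺; x∈p∩q⁻; x∈∁p⇒x∉p; x∉p⇒x∈∁p; nonempty?; Empty-unique; ∣⊥∣≡0;
         p─⊥≡p; p─q⊆p; x∈p∧x≢y⇒x∈p-y)
open import Data.Vec using (_∷_; here; there; lookup)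
open import Data.Fin.Properties using (suc-injective)
open import Data.Vec.Properties using ([]=⇒lookup; lookup⇒[]=; lookup∘tabulate)
open import Data.List using (List; []; _∷_; length)
open import Data.List.Membership.Propositional using () renaming (_∈_ to _∈ₗ_)
open import Data.List.Relation.Unary.Any using (here; there)
import Data.List.Relation.Unary.All as All
open import Data.List.Relation.Unary.AllPairs using (_∷_)
open import Data.List.Relation.Unary.Unique.Propositional using (Unique; [])
open import Data.Product using (proj₁; proj₂; ∃₂)
open import Data.Sum using (inj₁; inj₂)
open import Data.Unit using (tt)
open import Data.Empty using (⊥-elim)
open import Relation.Nullary using (yes; no; does)
open import Relation.Binary.PropositionalEquality

odd : ℕ → Bool
odd zero    = false
odd (suc k) = not (odd k)

odd≡false⇒2∣ : ∀ k → odd k ≡ false → 2 ∣ k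
odd≡false⇒2∣ zero          _ = divides 0 refl
odd≡false⇒2∣ (suc zero)    ()
odd≡false⇒2∣ (suc (suc k)) e with odd≡false⇒2∣ k (trans (sym (not-involutive (odd k))) e)
... | divides q k≡q*2 = divides (suc q) (cong (λ l → suc (suc l)) k≡q*2)

≢⇒one-≡ : ∀ {a b} → a ≢ b → ∀ i → a ≡ i ⊎ b ≡ i
≢⇒one-≡ {a} a≢b i with a ≟ᵇ i
... | yes a≡i = inj₁ a≡i
... | no  a≢i = inj₂ (trans (¬-not (a≢b ∘ sym)) (sym (¬-not (a≢i ∘ sym))))

1≤length : ∀ {A : Set} {x : A} {L : List A} → x ∈ₗ L → 1 ≤ length L
1≤length (here _)  = s≤s z≤n
1≤length (there _) = s≤s z≤n

2≤length : ∀ {A : Set} {x y : A} {L : List A} → x ≢ y → x ∈ₗ L → y ∈ₗ L → 2 ≤ length L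
2≤length x≢y (here refl) (here refl) = ⊥-elim (x≢y refl)
2≤length x≢y (here _)    (there y∈) = s≤s (1≤length y∈)
2≤length x≢y (there x∈)  (here _)   = s≤s (1≤length x∈)
2≤length x≢y (there x∈)  (there y∈) = m≤n⇒m≤1+n (2≤length x≢y x∈ y∈)

x∉p-x : ∀ {n} {x : Fin n} (p : Subset n) → x ∉ p - x
x∉p-x {x = zero}  (_ ∷ p) ()
x∉p-x {x = suc x} (_ ∷ p) (there x∈) = x∉p-x p x∈

x∈p⇒∣p∣≡1+∣p-x∣ : ∀ {n} {x : Fin n} {p : Subset n} → x ∈ p → ∣ p ∣ ≡ suc ∣ p - x ∣
x∈p⇒∣p∣≡1+∣p-x∣ {p = true ∷ p} here = cong suc (cong ∣_∣ (sym (p─⊥≡p p)))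
x∈p⇒∣p∣≡1+∣p-x∣ {p = true  ∷ p} (there x∈) = cong suc (x∈p⇒∣p∣≡1+∣p-x∣ x∈)
x∈p⇒∣p∣≡1+∣p-x∣ {p = false ∷ p} (there x∈) = x∈p⇒∣p∣≡1+∣p-x∣ x∈

2≤∣p∣ : ∀ {n} {x y : Fin n} {p : Subset n} → x ≢ y → x ∈ p → y ∈ p → 2 ≤ ∣ p ∣
2≤∣p∣ x≢y x∈ y∈
  rewrite x∈p⇒∣p∣≡1+∣p-x∣ x∈ | x∈p⇒∣p∣≡1+∣p-x∣ (x∈p∧x≢y⇒x∈p-y y∈ (x≢y ∘ sym)) = s≤s (s≤s z≤n)

∣p∣≡length : ∀ {n} {p : Subset n} {L : List (Fin n)} → Unique L →
             (∀ {j} → j ∈ p → j ∈ₗ L) → (∀ {j} → j ∈ₗ L → j ∈ p) → ∣ p ∣ ≡ length L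
∣p∣≡length {n} {p} {[]} [] p⊆L _ =
  trans (cong ∣_∣ (Empty-unique (λ (j , j∈) → case p⊆L j∈ of λ ()))) (∣⊥∣≡0 n)
∣p∣≡length {p = p} {x ∷ L} (x∉L ∷ L!) p⊆xL xL⊆p =
  trans (x∈p⇒∣p∣≡1+∣p-x∣ (xL⊆p (here refl))) (cong suc (∣p∣≡length L! p-x⊆L L⊆p-x))
  where
  p-x⊆L : ∀ {j} → j ∈ p - x → j ∈ₗ L
  p-x⊆L {j} j∈ with p⊆xL (p─q⊆p p _ j∈)
  ... | here refl = ⊥-elim (x∉p-x p j∈)
  ... | there j∈L = j∈L
  L⊆p-x : ∀ {j} → j ∈ₗ L → j ∈ p - x
  L⊆p-x j∈L = x∈p∧x≢y⇒x∈p-y (xL⊆p (there j∈L)) (λ { refl → All.lookup x∉L j∈L refl })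

module _ {n m : ℕ} {A : Fin m → Set} {E : Fin m → Subset n} where

  data Step : ∀ {x y es} → Walk A E x y es → Fin n → Fin m → Fin n → Set where
    now   : ∀ {u v w e es a d p q} {W : Walk A E v w es} →
            Step (step {u = u} {v} {w} {e} {es} a d p q W) u e v
    later : ∀ {u v w e es a d p q x j y} {W : Walk A E v w es} → Step W x j y →
            Step (step {u = u} {v} {w} {e} {es} a d p q W) x j y

  Step-ends : ∀ {x y es u j v} {W : Walk A E x y es} → Step W u j v → u ∈ E j × v ∈ E j
  Step-ends (now {p = p} {q}) = p , q
  Step-ends (later s)         = Step-ends s

  Step-≢ : ∀ {x y es u j v} {W : Walk A E x y es} → Step W u j v → u ≢ v
  Step-≢ (now {d = d}) = d
  Step-≢ (later s)     = Step-≢ s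

  Step-∈edges : ∀ {x y es u j v} {W : Walk A E x y es} → Step W u j v → j ∈ₗ es
  Step-∈edges now       = here refl
  Step-∈edges (later s) = there (Step-∈edges s)

  Step⇒Traverses-source : ∀ {x y es u j v} {W : Walk A E x y es} → Step W u j v → Traverses A E W u j
  Step⇒Traverses-source now       = here-l
  Step⇒Traverses-source (later s) = there (Step⇒Traverses-source s)

  Step⇒Traverses-target : ∀ {x y es u j v} {W : Walk A E x y es} → Step W u j v → Traverses A E W v j
  Step⇒Traverses-target now       = here-r
  Step⇒Traverses-target (later s) = there (Step⇒Traverses-target s)

  ∈edges⇒Step : ∀ {x y es j} (W : Walk A E x y es) → j ∈ₗ es → ∃₂ λ u v → Step W u j v
  ∈edges⇒Step (step _ _ _ _ W) (here refl) = _ , _ , now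
  ∈edges⇒Step (step _ _ _ _ W) (there j∈)  =
    let u , v , s = ∈edges⇒Step W j∈ in u , v , later s

  Step-unique : ∀ {x y es u u' j v v'} {W : Walk A E x y es} → Unique es →
                Step W u j v → Step W u' j v' → u ≡ u' × v ≡ v'
  Step-unique _          now       now       = refl , refl
  Step-unique (e∉ ∷ _)   now       (later t) = ⊥-elim (All.lookup e∉ (Step-∈edges t) refl)
  Step-unique (e∉ ∷ _)   (later s) now       = ⊥-elim (All.lookup e∉ (Step-∈edges s) refl)
  Step-unique (_ ∷ es!)  (later s) (later t) = Step-unique es! s t

  Step-subst-start : ∀ {x x' y es u j v} {W : Walk A E x y es} (x≡x' : x ≡ x') →
                     Step W u j v → Step (subst (λ z → Walk A E z y es) x≡x' W) u j v
  Step-subst-start refl s = s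

module _ {n m : ℕ} {A A' : Fin m → Set} {E E' : Fin m → Subset n} where

  map-walk : ∀ {x y es} (W : Walk A E x y es) →
             (∀ {u j v} → Step W u j v → A' j × u ∈ E' j × v ∈ E' j) → Walk A' E' x y es
  map-walk []                 _  = []
  map-walk (step _ d _ _ W) ok =
    let a' , p' , q' = ok now in step a' d p' q' (map-walk W (λ s → ok (later s)))

module _ {n n' m : ℕ} {A A' : Fin m → Set} {E : Fin m → Subset n} {E' : Fin m → Subset n'}
         (φ : Fin n → Fin n') where

  record Contraction {x y es} (W : Walk A E x y es) : Set where
    field
      edges  : List (Fin m)
      walk   : Walk A' E' (φ x) (φ y) edges
      edges⊆ : ∀ {k} → k ∈ₗ edges → k ∈ₗ es
      unique : Unique edges
      keeps  : ∀ {u j v} → Step W u j v → φ u ≢ φ v → Step walk (φ u) j (φ v)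

  -- Steps whose ends are identified by φ are deleted.
  contract : ∀ {x y es} (W : Walk A E x y es) → Unique es →
             (∀ {u j v} → Step W u j v → φ u ≢ φ v → A' j × φ u ∈ E' j × φ v ∈ E' j) →
             Contraction W
  contract [] _ _ = record
    { edges = [] ; walk = [] ; edges⊆ = λ () ; unique = [] ; keeps = λ () }
  contract (step {u} {v} {w} {e} _ _ _ _ W) (e∉ ∷ es!) ok
    with contract W es! (λ s → ok (later s)) | φ u ≟ φ v
  ... | C | yes φu≡φv = record
    { edges  = C.edges
    ; walk   = subst (λ z → Walk A' E' z (φ w) C.edges) (sym φu≡φv) C.walk
    ; edges⊆ = there ∘ C.edges⊆
    ; unique = C.unique
    ; keeps  = λ { now φu≢φv → ⊥-elim (φu≢φv φu≡φv)
                 ; (later s) ne → Step-subst-start (sym φu≡φv) (C.keeps s ne) }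
    }
    where module C = Contraction C
  ... | C | no φu≢φv = record
    { edges  = e ∷ C.edges
    ; walk   = step a' φu≢φv p' q' C.walk
    ; edges⊆ = λ { (here refl) → here refl ; (there k∈) → there (C.edges⊆ k∈) }
    ; unique = All.tabulate (λ k∈ → All.lookup e∉ (C.edges⊆ k∈)) ∷ C.unique
    ; keeps  = λ { now _ → now ; (later s) ne → later (C.keeps s ne) }
    }
    where
    module C = Contraction C
    a' = proj₁ (ok now φu≢φv)
    p' = proj₁ (proj₂ (ok now φu≢φv))
    q' = proj₂ (proj₂ (ok now φu≢φv))

module Crossings {n m : ℕ} {A : Fin m → Set} {E : Fin m → Subset n} (side : Fin n → Bool) where

  crossings : ∀ {x y es} → Walk A E x y es → List (Fin m)
  crossings [] = []
  crossings (step {u} {v} {e = e} _ _ _ _ W) with side u ≟ᵇ side v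
  ... | yes _ = crossings W
  ... | no  _ = e ∷ crossings W

  ∈crossings⇒Step : ∀ {x y es j} (W : Walk A E x y es) → j ∈ₗ crossings W →
                    ∃₂ λ u v → Step W u j v × side u ≢ side v
  ∈crossings⇒Step (step {u} {v} _ _ _ _ W) j∈ with side u ≟ᵇ side v | j∈
  ... | yes _ | j∈W = let u' , v' , s , ≢ = ∈crossings⇒Step W j∈W in u' , v' , later s , ≢
  ... | no ≢  | here refl = u , v , now , ≢
  ... | no _  | there j∈W = let u' , v' , s , ≢ = ∈crossings⇒Step W j∈W in u' , v' , later s , ≢

  Step⇒∈crossings : ∀ {x y es u j v} {W : Walk A E x y es} → Step W u j v → side u ≢ side v →
                    j ∈ₗ crossings W
  Step⇒∈crossings (now {u = u} {v}) ≢ with side u ≟ᵇ side v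
  ... | yes ≡ = ⊥-elim (≢ ≡)
  ... | no  _ = here refl
  Step⇒∈crossings (later {u = u} {v} s) ≢ with side u ≟ᵇ side v
  ... | yes _ = Step⇒∈crossings s ≢
  ... | no  _ = there (Step⇒∈crossings s ≢)

  crossings-unique : ∀ {x y es} (W : Walk A E x y es) → Unique es → Unique (crossings W)
  crossings-unique [] _ = []
  crossings-unique (step {u} {v} _ _ _ _ W) (e∉ ∷ es!) with side u ≟ᵇ side v
  ... | yes _ = crossings-unique W es!
  ... | no  _ = All.tabulate (λ k∈ → All.lookup e∉ (⊆edges k∈)) ∷ crossings-unique W es!
    where
    ⊆edges : ∀ {k} → k ∈ₗ crossings W → k ∈ₗ _
    ⊆edges k∈ = let _ , _ , s , _ = ∈crossings⇒Step W k∈ in Step-∈edges s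

  crossings-parity : ∀ {x y es} (W : Walk A E x y es) →
                     odd (length (crossings W)) ≡ side x xor side y
  crossings-parity {x} [] = sym (xor-same (side x))
  crossings-parity (step {u} {v} {w} _ _ _ _ W) with side u ≟ᵇ side v
  ... | yes u≡v = trans (crossings-parity W) (cong (_xor side w) (sym u≡v))
  ... | no  u≢v = begin
    not (odd (length (crossings W))) ≡⟨ cong not (crossings-parity W) ⟩
    not (side v xor side w)          ≡⟨ not-distribˡ-xor (side v) (side w) ⟩
    not (side v) xor side w          ≡⟨ cong (_xor side w) (sym (¬-not u≢v)) ⟩
    side u xor side w                ∎
    where open ≡-Reasoning

  uncrossed⇒side≡ : ∀ {x y es u j v} {W : Walk A E x y es} → crossings W ≡ [] →
                    Step W u j v → side u ≡ side v
  uncrossed⇒side≡ {u = u} {v = v} none s with side u ≟ᵇ side v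
  ... | yes u≡v = u≡v
  ... | no  u≢v = case subst (_ ∈ₗ_) none (Step⇒∈crossings s u≢v) of λ ()

  side-preserved⇒side≡start : ∀ {x y es u j v} {W : Walk A E x y es} →
                             (∀ {u' j' v'} → Step W u' j' v' → side u' ≡ side v') →
                             Step W u j v → side u ≡ side x
  side-preserved⇒side≡start preserved now       = refl
  side-preserved⇒side≡start preserved (later s) =
    trans (side-preserved⇒side≡start (λ t → preserved (later t)) s) (sym (preserved now))

side : ∀ {n} → Subset n → Fin n → Bool
side V₀ v = not (does (v ∈? V₀))

module _ {n : ℕ} {V₀ : Subset n} where

  ∈part-side : ∀ v → v ∈ part V₀ (side V₀ v)
  ∈part-side v with v ∈? V₀
  ... | yes v∈ = v∈
  ... | no  v∉ = x∉p⇒x∈∁p v∉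

  ∈part⇒side≡ : ∀ {v i} → v ∈ part V₀ i → side V₀ v ≡ i
  ∈part⇒side≡ {v} {false} v∈ with v ∈? V₀
  ... | yes _  = refl
  ... | no  v∉ = ⊥-elim (v∉ v∈)
  ∈part⇒side≡ {v} {true} v∈ with v ∈? V₀
  ... | yes v∈V₀ = ⊥-elim (x∈∁p⇒x∉p v∈ v∈V₀)
  ... | no  _    = refl

  side≡⇒∈part : ∀ {v i} → side V₀ v ≡ i → v ∈ part V₀ i
  side≡⇒∈part {v} refl = ∈part-side v

  straddling⇒meets-part : ∀ {u v e} → u ∈ e → v ∈ e → side V₀ u ≢ side V₀ v →
                          ∀ i → Nonempty (e ∩ part V₀ i)
  straddling⇒meets-part {u} {v} u∈ v∈ u≢v i with ≢⇒one-≡ u≢v i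
  ... | inj₁ u≡i = u , x∈p∩q⁺ (u∈ , side≡⇒∈part u≡i)
  ... | inj₂ v≡i = v , x∈p∩q⁺ (v∈ , side≡⇒∈part v≡i)

module _ {n m : ℕ} {E : Fin m → Subset n} {F : Subset m} {V₀ : Subset n}
         (uc₀ : UnionOfComponents E F V₀) (uc₁ : UnionOfComponents E F (∁ V₀)) where

  uncut-edge⇒side≡ : ∀ {j u v} → j ∉ F → u ∈ E j → v ∈ E j → side V₀ u ≡ side V₀ v
  uncut-edge⇒side≡ {j} {u} {v} j∉F u∈ v∈ with u ≟ v
  ... | yes refl = refl
  ... | no  u≢v  = sym (∈part⇒side≡ (closed (side V₀ u) (∈part-side u)))
    where
    closed : ∀ i → u ∈ part V₀ i → v ∈ part V₀ i
    closed false u∈V₀ = uc₀ u v (j ∷ []) u∈V₀ (step j∉F u≢v u∈ v∈ [])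
    closed true  u∈V₁ = uc₁ u v (j ∷ []) u∈V₁ (step j∉F u≢v u∈ v∈ [])

diag : Bool → Z2²
diag false = c00
diag true  = c11

class : Bool → Bool → Z2²
class false false = c00
class true  true  = c11
class false true  = c01
class true  false = c01

class-same : ∀ i → class i i ≡ diag i
class-same false = refl
class-same true  = refl

≢⇒class≡c01 : ∀ {a b} → a ≢ b → class a b ≡ c01
≢⇒class≡c01 {false} {false} a≢b = ⊥-elim (a≢b refl)
≢⇒class≡c01 {true}  {true}  a≢b = ⊥-elim (a≢b refl)
≢⇒class≡c01 {false} {true}  _   = refl
≢⇒class≡c01 {true}  {false} _   = refl

class≡c01⇒≢ : ∀ {a b} → class a b ≡ c01 → a ≢ b
class≡c01⇒≢ {false} () refl
class≡c01⇒≢ {true}  () refl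

class≡diag⇒≡ : ∀ {a b i} → class a b ≡ diag i → a ≡ i × b ≡ i
class≡diag⇒≡ {false} {false} {false} _ = refl , refl
class≡diag⇒≡ {true}  {true}  {true}  _ = refl , refl
class≡diag⇒≡ {false} {false} {true}  ()
class≡diag⇒≡ {true}  {true}  {false} ()
class≡diag⇒≡ {false} {true}  {false} ()
class≡diag⇒≡ {false} {true}  {true}  ()
class≡diag⇒≡ {true}  {false} {false} ()
class≡diag⇒≡ {true}  {false} {true}  ()

module EdgeCutAssignments {n m : ℕ} (E : Fin m → Subset n) (F : Subset m) (V₀ : Subset n) where

  restrictα-diag : ∀ i e → restrictα E F V₀ (diag i) e ≡ e ∩ part V₀ i
  restrictα-diag false e = refl
  restrictα-diag true  e = refl

  ∈restrictα-class : ∀ {u v e} → u ∈ e → v ∈ e →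
    let r = restrictα E F V₀ (class (side V₀ u) (side V₀ v)) e in u ∈ r × v ∈ r
  ∈restrictα-class {u} {v} u∈ v∈ with side V₀ u in u≡ | side V₀ v in v≡
  ... | false | false = x∈p∩q⁺ (u∈ , side≡⇒∈part u≡) , x∈p∩q⁺ (v∈ , side≡⇒∈part v≡)
  ... | true  | true  = x∈p∩q⁺ (u∈ , side≡⇒∈part u≡) , x∈p∩q⁺ (v∈ , side≡⇒∈part v≡)
  ... | false | true  = u∈ , v∈
  ... | true  | false = u∈ , v∈

  module ForAssignment (α : Fin m → Z2²) {j : Fin m} where

    edgeα-∈F : j ∈ F → edgeα E F V₀ α j ≡ restrictα E F V₀ (α j) (E j)
    edgeα-∈F j∈F rewrite []=⇒lookup j∈F = refl

    edgeα-∉F : j ∉ F → edgeα E F V₀ α j ≡ E j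
    edgeα-∉F j∉F with lookup F j in F[j]
    ... | true  = ⊥-elim (j∉F (lookup⇒[]= j F F[j]))
    ... | false = refl

    ∈preimage01⁺ : j ∈ F → α j ≡ c01 → j ∈ preimage01 E F V₀ α
    ∈preimage01⁺ j∈F α≡ with lookup (preimage01 E F V₀ α) j in pre[j]
    ... | true  = lookup⇒[]= j _ pre[j]
    ... | false with lookup F j | []=⇒lookup j∈F | α j | trans (sym (lookup∘tabulate _ j)) pre[j]
    ...   | true | refl | c00 | _  = case α≡ of λ ()
    ...   | true | refl | c11 | _  = case α≡ of λ ()
    ...   | true | refl | c01 | ()

    ∈preimage01⁻ : j ∈ preimage01 E F V₀ α → j ∈ F × α j ≡ c01
    ∈preimage01⁻ j∈ with lookup F j in F[j] | α j | trans (sym (lookup∘tabulate _ j)) ([]=⇒lookup j∈)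
    ... | true  | c01 | _ = lookup⇒[]= j F F[j] , refl
    ... | true  | c00 | ()
    ... | true  | c11 | ()
    ... | false | _   | ()

collapse : ∀ {n} → Subset n → Fin n → Fin (suc n)
collapse S v with v ∈? S
... | yes _ = collapsedVertex
... | no  _ = suc v

module _ {n : ℕ} {S : Subset n} where

  ∈⇒collapse≡ : ∀ {v} → v ∈ S → collapse S v ≡ collapsedVertex
  ∈⇒collapse≡ {v} v∈ with v ∈? S
  ... | yes _  = refl
  ... | no  v∉ = ⊥-elim (v∉ v∈)

  collapse-identifies : ∀ {u v} → collapse S u ≡ collapse S v → u ≢ v → u ∈ S × v ∈ S
  collapse-identifies {u} {v} eq u≢v with u ∈? S | v ∈? S
  ... | yes u∈ | yes v∈ = u∈ , v∈
  ... | yes _  | no  _  = case eq of λ ()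
  ... | no  _  | yes _  = case eq of λ ()
  ... | no  _  | no  _  = ⊥-elim (u≢v (suc-injective eq))

module _ {n m : ℕ} {E : Fin m → Subset n} {S : Subset n} where

  ∈⇒collapse∈collapsedEdge : ∀ {j v} → v ∈ E j → collapse S v ∈ collapsedEdge E S j
  ∈⇒collapse∈collapsedEdge {j} {v} v∈ with v ∈? S
  ... | no  v∉S = there (x∈p∩q⁺ (v∈ , x∉p⇒x∈∁p v∉S))
  ... | yes v∈S with nonempty? (E j ∩ S)
  ...   | yes _   = here
  ...   | no  E∩S = ⊥-elim (E∩S (v , x∈p∩q⁺ (v∈ , v∈S)))

  collapse-step : ∀ {j u v} → u ∈ E j → v ∈ E j → collapse S u ≢ collapse S v →
                  collapsedAct E S j × collapse S u ∈ collapsedEdge E S j × collapse S v ∈ collapsedEdge E S j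
  collapse-step {j} {u} {v} u∈ v∈ φu≢φv =
    active , ∈⇒collapse∈collapsedEdge u∈ , ∈⇒collapse∈collapsedEdge v∈
    where
    active : collapsedAct E S j
    active with u ∈? S | v ∈? S
    ... | no  u∉S | _       = u , x∈p∩q⁺ (u∈ , x∉p⇒x∈∁p u∉S)
    ... | yes _   | no  v∉S = v , x∈p∩q⁺ (v∈ , x∉p⇒x∈∁p v∉S)
    ... | yes _   | yes _   = ⊥-elim (φu≢φv refl)

module Tour {n m : ℕ} (E : Fin m → Subset n) (F : Subset m) (V₀ : Subset n)
  (uc₀ : UnionOfComponents E F V₀) (uc₁ : UnionOfComponents E F (∁ V₀))
  (T : EulerTour (λ _ → ⊤) E) where

  open EulerTour T
  open Crossings {A = λ _ → ⊤} {E = E} (side V₀)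
  open EdgeCutAssignments E F V₀

  side₀ : Fin n → Bool
  side₀ = side V₀

  traversal : ∀ j → ∃₂ λ u v → Step walk u j v
  traversal j = ∈edges⇒Step walk (covers j tt)

  α : Fin m → Z2²
  α j = let u , v , _ = traversal j in class (side₀ u) (side₀ v)

  α-Step : ∀ {u j v} → Step walk u j v → α j ≡ class (side₀ u) (side₀ v)
  α-Step {j = j} s =
    let u≡ , v≡ = Step-unique trail (proj₂ (proj₂ (traversal j))) s
    in cong₂ class (cong side₀ u≡) (cong side₀ v≡)

  α-isEdgeCutAssignment : IsEdgeCutAssignment E F V₀ α
  α-isEdgeCutAssignment j _ =
    let _ , _ , s = traversal j in meets-both s , two-in s false , two-in s true
    where
    meets-both : ∀ {u v} → Step walk u j v → α j ≡ c01 →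
                 Nonempty (E j ∩ part V₀ false) × Nonempty (E j ∩ part V₀ true)
    meets-both s α≡ =
      let u≢v = class≡c01⇒≢ (trans (sym (α-Step s)) α≡)
          u∈ , v∈ = Step-ends s
      in straddling⇒meets-part u∈ v∈ u≢v false , straddling⇒meets-part u∈ v∈ u≢v true

    two-in : ∀ {u v} → Step walk u j v → ∀ i → α j ≡ diag i → 2 ≤ ∣ E j ∩ part V₀ i ∣
    two-in s i α≡ =
      let u≡i , v≡i = class≡diag⇒≡ (trans (sym (α-Step s)) α≡)
          u∈ , v∈ = Step-ends s
      in 2≤∣p∣ (Step-≢ s) (x∈p∩q⁺ (u∈ , side≡⇒∈part u≡i)) (x∈p∩q⁺ (v∈ , side≡⇒∈part v≡i))

  open ForAssignment α

  Eα : Fin m → Subset n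
  Eα = edgeα E F V₀ α

  Eα-cut : ∀ {u j v} → Step walk u j v → j ∈ F →
           Eα j ≡ restrictα E F V₀ (class (side₀ u) (side₀ v)) (E j)
  Eα-cut {j = j} s j∈F = trans (edgeα-∈F j∈F) (cong (λ a → restrictα E F V₀ a (E j)) (α-Step s))

  Step-ends-α : ∀ {u j v} → Step walk u j v → u ∈ Eα j × v ∈ Eα j
  Step-ends-α {u} {j} {v} s with j ∈? F
  ... | no  j∉F = subst (λ e → u ∈ e × v ∈ e) (sym (edgeα-∉F j∉F)) (Step-ends s)
  ... | yes j∈F = subst (λ e → u ∈ e × v ∈ e) (sym (Eα-cut s j∈F))
                        (∈restrictα-class (proj₁ (Step-ends s)) (proj₂ (Step-ends s)))

  Eα-one-sided : ∀ {u j v x} → Step walk u j v → side₀ u ≡ side₀ v → x ∈ Eα j → side₀ x ≡ side₀ u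
  Eα-one-sided {u} {j} {v} {x} s u≡v x∈ with j ∈? F
  ... | no  j∉F =
    uncut-edge⇒side≡ uc₀ uc₁ j∉F (subst (x ∈_) (edgeα-∉F j∉F) x∈) (proj₁ (Step-ends s))
  ... | yes j∈F = ∈part⇒side≡ (proj₂ (x∈p∩q⁻ (E j) _ (subst (x ∈_) Eα≡ x∈)))
    where
    open ≡-Reasoning
    Eα≡ : Eα j ≡ E j ∩ part V₀ (side₀ u)
    Eα≡ = begin
      Eα j
        ≡⟨ Eα-cut s j∈F ⟩
      restrictα E F V₀ (class (side₀ u) (side₀ v)) (E j)
        ≡⟨ cong (λ a → restrictα E F V₀ a (E j))
                (trans (cong (class (side₀ u)) (sym u≡v)) (class-same (side₀ u))) ⟩
      restrictα E F V₀ (diag (side₀ u)) (E j)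
        ≡⟨ restrictα-diag (side₀ u) (E j) ⟩
      E j ∩ part V₀ (side₀ u)
        ∎

  crossing⇒∈F : ∀ {u j v} → Step walk u j v → side₀ u ≢ side₀ v → j ∈ F
  crossing⇒∈F {j = j} s u≢v with j ∈? F
  ... | yes j∈F = j∈F
  ... | no  j∉F = ⊥-elim (u≢v (uncut-edge⇒side≡ uc₀ uc₁ j∉F (proj₁ (Step-ends s)) (proj₂ (Step-ends s))))

  pre : Subset m
  pre = preimage01 E F V₀ α

  ∈pre⇒∈crossings : ∀ {j} → j ∈ pre → j ∈ₗ crossings walk
  ∈pre⇒∈crossings {j} j∈ =
    let _ , α≡ = ∈preimage01⁻ j∈
        _ , _ , s = traversal j
    in Step⇒∈crossings s (class≡c01⇒≢ (trans (sym (α-Step s)) α≡))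

  ∈crossings⇒∈pre : ∀ {j} → j ∈ₗ crossings walk → j ∈ pre
  ∈crossings⇒∈pre j∈ =
    let _ , _ , s , u≢v = ∈crossings⇒Step walk j∈
    in ∈preimage01⁺ (crossing⇒∈F s u≢v) (trans (α-Step s) (≢⇒class≡c01 u≢v))

  crossings-even : odd (length (crossings walk)) ≡ false
  crossings-even = trans (crossings-parity walk) (xor-same (side₀ start))

  ∣pre∣-even : 2 ∣ ∣ pre ∣
  ∣pre∣-even = subst (2 ∣_)
    (sym (∣p∣≡length (crossings-unique walk trail) ∈pre⇒∈crossings ∈crossings⇒∈pre))
    (odd≡false⇒2∣ _ crossings-even)

  module Uncrossed (none : crossings walk ≡ []) where

    i : Bool
    i = side₀ start

    preserved : ∀ {u j v} → Step walk u j v → side₀ u ≡ side₀ v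
    preserved = uncrossed⇒side≡ none

    on-side-i : ∀ {u j v} → Step walk u j v → side₀ u ≡ i × side₀ v ≡ i
    on-side-i s = let u≡i = side-preserved⇒side≡start preserved s in u≡i , trans (sym (preserved s)) u≡i

    pre-empty : Empty pre
    pre-empty (j , j∈) = case subst (j ∈ₗ_) none (∈pre⇒∈crossings j∈) of λ ()

    induced-tour : InducedHasEulerTour Eα (part V₀ i)
    induced-tour = record
      { start = start ; edges = edges ; walk = map-walk walk inside ; closed = closed
      ; trail = trail ; covers = λ j _ → covers j tt }
      where
      P : Subset n
      P = part V₀ i
      inside : ∀ {u j v} → Step walk u j v →
               inducedAct Eα P j × u ∈ inducedEdge Eα P j × v ∈ inducedEdge Eα P j
      inside {u} s =
        let u∈ , v∈ = Step-ends-α s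
            u≡i , v≡i = on-side-i s
            u∈′ = x∈p∩q⁺ (u∈ , side≡⇒∈part u≡i)
        in (u , u∈′) , u∈′ , x∈p∩q⁺ (v∈ , side≡⇒∈part v≡i)

    other-side-empty : InducedEmpty Eα (part V₀ (not i))
    other-side-empty j (x , x∈) =
      let x∈Eα , x∈P = x∈p∩q⁻ (Eα j) _ x∈
          _ , _ , s = traversal j
      in not-¬ (trans (Eα-one-sided s (preserved s) x∈Eα) (proj₁ (on-side-i s))) (∈part⇒side≡ x∈P)

  module Crossed {c₀ c₁ cs} (two : crossings walk ≡ c₀ ∷ c₁ ∷ cs) (i : Bool) where

    S : Subset n
    S = part V₀ i

    φ : Fin n → Fin (suc n)
    φ = collapse S

    C : Contraction {A' = collapsedAct Eα S} {E' = collapsedEdge Eα S} φ walk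
    C = contract φ walk trail λ s → collapse-step {E = Eα} (proj₁ (Step-ends-α s)) (proj₂ (Step-ends-α s))
    module C = Contraction C

    one-sided-if-identified : ∀ {u j v} → Step walk u j v → φ u ≡ φ v → side₀ u ≡ i × side₀ v ≡ i
    one-sided-if-identified s φu≡φv =
      let u∈S , v∈S = collapse-identifies φu≡φv (Step-≢ s) in ∈part⇒side≡ u∈S , ∈part⇒side≡ v∈S

    crossing-kept : ∀ {u j v} → Step walk u j v → side₀ u ≢ side₀ v → Step C.walk (φ u) j (φ v)
    crossing-kept s u≢v = C.keeps s λ φu≡φv →
      let u≡i , v≡i = one-sided-if-identified s φu≡φv in u≢v (trans u≡i (sym v≡i))

    crossing∈edges : ∀ {j} → j ∈ₗ crossings walk → j ∈ₗ C.edges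
    crossing∈edges j∈ = let _ , _ , s , u≢v = ∈crossings⇒Step walk j∈ in Step-∈edges (crossing-kept s u≢v)

    active∈edges : ∀ j → collapsedAct Eα S j → j ∈ₗ C.edges
    active∈edges j (x , x∈) = let _ , _ , s = traversal j in Step-∈edges (C.keeps s (not-identified s))
      where
      not-identified : ∀ {u v} → Step walk u j v → φ u ≢ φ v
      not-identified s φu≡φv =
        let u≡i , v≡i = one-sided-if-identified s φu≡φv
            x∈Eα , x∈∁S = x∈p∩q⁻ (Eα j) (∁ S) x∈
        in x∈∁p⇒x∉p x∈∁S (side≡⇒∈part (trans (Eα-one-sided s (trans u≡i (sym v≡i)) x∈Eα) u≡i))

    c₀≢c₁ : c₀ ≢ c₁
    c₀≢c₁ with subst Unique two (crossings-unique walk trail)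
    ... | c₀∉ ∷ _ = All.head c₀∉

    collapsed-tour : CollapsedEulerTour Eα S
    collapsed-tour = record
      { start = φ start ; edges = C.edges ; walk = C.walk
      ; closed = 2≤length c₀≢c₁ (crossing∈edges (subst (c₀ ∈ₗ_) (sym two) (here refl)))
                                (crossing∈edges (subst (c₁ ∈ₗ_) (sym two) (there (here refl))))
      ; trail = C.unique ; covers = active∈edges }

    traverses-collapsed : ∀ j → j ∈ pre →
      Traverses (collapsedAct Eα S) (collapsedEdge Eα S) C.walk collapsedVertex j
    traverses-collapsed j j∈ with ∈crossings⇒Step walk (∈pre⇒∈crossings j∈)
    ... | u , v , s , u≢v with ≢⇒one-≡ u≢v i
    ...   | inj₁ u≡i = subst (λ z → Traverses _ _ C.walk z j) (∈⇒collapse≡ (side≡⇒∈part u≡i))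
                             (Step⇒Traverses-source (crossing-kept s u≢v))
    ...   | inj₂ v≡i = subst (λ z → Traverses _ _ C.walk z j) (∈⇒collapse≡ (side≡⇒∈part v≡i))
                             (Step⇒Traverses-target (crossing-kept s u≢v))

  dichotomy :
    (Empty pre ×
      ∃ λ i → InducedHasEulerTour Eα (part V₀ i) × InducedEmpty Eα (part V₀ (not i)))
    ⊎
    (Nonempty pre ×
      ∀ i → Σ (CollapsedEulerTour Eα (part V₀ i)) λ T′ →
              ∀ j → j ∈ pre →
                Traverses (collapsedAct Eα (part V₀ i)) (collapsedEdge Eα (part V₀ i))
                          (EulerTour.walk T′) collapsedVertex j)
  dichotomy with crossings walk in eq
  ... | [] = inj₁ (pre-empty , i , induced-tour , other-side-empty)
    where open Uncrossed eq
  ... | _ ∷ [] = case subst (λ L → odd (length L) ≡ false) eq crossings-even of λ ()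
  ... | c₀ ∷ _ ∷ _ = inj₂ ((c₀ , ∈crossings⇒∈pre (subst (c₀ ∈ₗ_) (sym eq) (here refl))) ,
                          λ i → let open Crossed eq i in collapsed-tour , traverses-collapsed)

corollary6p3 : ∀ {n m : ℕ} (E : Fin m → Subset n) (F : Subset m) (V₀ : Subset n) →
    Connected (λ _ → ⊤) E →
    IsMinimalEdgeCut E F →
    Nonempty V₀ → Nonempty (∁ V₀) →
    UnionOfComponents E F V₀ → UnionOfComponents E F (∁ V₀) →
    EulerTour (λ _ → ⊤) E →
    ∃ λ (α : Fin m → Z2²) →
      IsEdgeCutAssignment E F V₀ α ×
      (2 ∣ ∣ preimage01 E F V₀ α ∣) ×
      ((Empty (preimage01 E F V₀ α) ×
         (∃ λ (i : Bool) →
            InducedHasEulerTour (edgeα E F V₀ α) (part V₀ i) ×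
            InducedEmpty (edgeα E F V₀ α) (part V₀ (not i))))
       ⊎
       (Nonempty (preimage01 E F V₀ α) ×
         (∀ (i : Bool) →
            Σ (CollapsedEulerTour (edgeα E F V₀ α) (part V₀ i)) λ T →
              ∀ j → j ∈ preimage01 E F V₀ α →
                Traverses (collapsedAct (edgeα E F V₀ α) (part V₀ i))
                          (collapsedEdge (edgeα E F V₀ α) (part V₀ i))
                          (EulerTour.walk T) collapsedVertex j)))
corollary6p3 E F V₀ _ _ _ _ uc₀ uc₁ T = α , α-isEdgeCutAssignment , ∣pre∣-even , dichotomy
  where open Tour E F V₀ uc₀ uc₁ T
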